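{- Let $p>3$ be a prime, $t\in \{1,3,p,3p\}$, and $1\leqslant r\leqslant 3p-1$ with $\gcd(r,3p)=1$. Then \[\mathcal{S}(p,r,t)=\begin{cases} p & \text{if } r\equiv 2\pmod 3 \text{ and } |r|_p\text{ is odd},\\ 0 & \text{otherwise}. \end{cases}\]
   Context: $\phi$ is Euler's totient function; $|r|_m$ is the multiplicative order of $r$ modulo $m$. $S_k(x)=1+x+\cdots+x^{k-1}$ for $k\ge1$, $S_0(x)=0$; for a positive integer $m$ with $\gcd(r,m)=1$, $\kappa(m,r,t)=\dfrac{m|r|_m}{\gcd(m,\ tS_{|r|_m}(r))}$. For a divisor $d$ of $3p$, $\Lambda(d,r,t)=\{\ell>0\mid \ell \text{ divides } \frac{|r|_{3p}}{\gcd(\kappa(d,r,t),|r|_{3p})} \text{ and } \gcd(r^{\ell\kappa(d,r,t)}-1,3p)=d\}$ and $\mathcal{S}(d,r,t)=\sum_{\ell\in \Lambda(d,r,t)} d\,\phi\!\left(\frac{|r|_{3p}}{\ell \gcd(\kappa(d,r,t),|r|_{3p})}\right)$. -}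

module Defs where

open import Data.Nat using (ℕ; zero; suc; _+_; _*_; _∸_; _^_; _/_)
open import Data.Nat.Divisibility using (_∣?_)
open import Data.Nat.GCD using (gcd)
open import Data.Bool using (Bool; if_then_else_)
open import Data.List using (List; applyUpTo; filter; length; map)
open import Data.Nat.ListAction using (sum)
open import Relation.Nullary.Decidable using (⌊_⌋)
import Data.Nat as N
import Data.Bool

-- division with the convention  m div 0 = 0  (only ever used with non-zero divisors)
_div_ : ℕ → ℕ → ℕ
m div zero    = 0
m div (suc n) = m / suc n

range1 : ℕ → List ℕ
range1 n = applyUpTo suc n

φ : ℕ → ℕ
φ n = length (filter (λ k → gcd k n N.≟ 1) (range1 n))

-- multiplicative order |r|_m : least k ≥ 1 with m ∣ r^k − 1.
-- The search runs over k = 1..m; for gcd(r,m) = 1, m ≥ 1, r ≥ 1 the order is ≤ φ(m) ≤ m,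
-- so this is the true order in every case where it is used.
ordSearch : ℕ → ℕ → ℕ → ℕ → ℕ
ordSearch m r zero    k = 0
ordSearch m r (suc f) k = if ⌊ m ∣? (r ^ k ∸ 1) ⌋ then k else ordSearch m r f (suc k)

ord : ℕ → ℕ → ℕ
ord m r = ordSearch m r m 1

S : ℕ → ℕ → ℕ
S zero    x = 0
S (suc k) x = S k x + x ^ k

κ : ℕ → ℕ → ℕ → ℕ
κ m r t = (m * ord m r) div gcd m (t * S (ord m r) r)

-- Everything below is relative to the modulus 3p; the first argument is p.
-- M(d,r,t) = |r|_{3p} / gcd(κ(d,r,t), |r|_{3p})
Mbound : ℕ → ℕ → ℕ → ℕ → ℕ
Mbound p d r t = ord (3 * p) r div gcd (κ d r t) (ord (3 * p) r)

inΛ : ℕ → ℕ → ℕ → ℕ → ℕ → Bool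
inΛ p d r t ℓ =
  ⌊ ℓ ∣? Mbound p d r t ⌋ Data.Bool.∧ ⌊ gcd (r ^ (ℓ * κ d r t) ∸ 1) (3 * p) N.≟ d ⌋

-- Λ(d,r,t) as a list; every element of Λ divides M ≥ 1, hence lies in 1..M
Λ : ℕ → ℕ → ℕ → ℕ → List ℕ
Λ p d r t = filter (λ ℓ → Data.Bool._≟_ (inΛ p d r t ℓ) Data.Bool.true) (range1 (Mbound p d r t))

𝒮 : ℕ → ℕ → ℕ → ℕ → ℕ
𝒮 p d r t = sum (map (λ ℓ → d * φ (ord (3 * p) r div (ℓ * gcd (κ d r t) (ord (3 * p) r)))) (Λ p d r t))

module Submission where

-- Since p is prime, κ(p,r,t) is |r|_p or p|r|_p, so p divides r^(ℓκ) − 1 for every ℓ and ℓ lies in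
-- Λ(p,r,t) exactly when 3 ∤ r^(ℓκ) − 1. As |r|_3 is 1 or 2, this needs r ≡ 2 (mod 3) and ℓκ odd,
-- and κ is odd iff |r|_p is. Otherwise Λ(p,r,t) is empty. In the odd case |r|_{3p} = 2|r|_p and
-- gcd(κ, 2|r|_p) = |r|_p, so ℓ ranges over {1, 2}, Λ(p,r,t) = {1} and 𝒮(p,r,t) = p φ(2) = p.

open import Defs
open import Data.Bool as Bool using (true; false; _∧_)
open import Data.Bool.Properties using (not-¬; ∧-zeroʳ)
open import Data.List using ([]; _∷_; map; filter)
open import Data.List.Properties using (filter-none; filter-accept; filter-reject)
open import Data.List.Relation.Unary.All.Properties using (applyUpTo⁺₂)
open import Data.Nat
  using (ℕ; zero; suc; _+_; _*_; _∸_; _^_; _/_; _%_; _≤_; _<_; z≤n; s≤s; s≤s⁻¹; z<s;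
         NonZero; >-nonZero; ≢-nonZero; ≢-nonZero⁻¹)
open import Data.Nat.Coprimality using (Coprime; coprime-divisor; prime⇒coprime) renaming (sym to Coprime-sym)
open import Data.Nat.Divisibility
open import Data.Nat.DivMod
  using (m≡m%n+[m/n]*n; m%n<n; [m+kn]%n≡m%n; m<n⇒m%n≡m; %-distribˡ-*; m%n%n≡m%n; *-/-assoc; m*n/n≡m)
open import Data.Nat.GCD using (gcd; gcd[m,n]∣m; gcd[m,n]∣n; gcd[m,n]≢0; gcd-greatest)
open import Data.Nat.ListAction using (sum)
open import Data.Nat.Primality
  using (Prime; prime⇒irreducible; prime⇒nonZero; composite; prime?; prime[2]; euclidsLemma)
open import Data.Nat.Properties
open import Data.Nat.Tactic.RingSolver using (solve-∀)
open import Data.Product using (_×_; _,_; proj₁; proj₂)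
open import Data.Sum using (_⊎_; inj₁; inj₂; [_,_]′)
open import Function using (_∘_)
open import Relation.Nullary using (¬_; Dec; yes; no; contradiction)
open import Relation.Nullary.Decidable using (⌊_⌋; isYes≗does; dec-true; dec-false; decidable-stable; from-yes)
open import Relation.Unary using (Decidable)
open import Relation.Binary.PropositionalEquality
  using (_≡_; _≢_; refl; sym; trans; cong; cong₂; subst; module ≡-Reasoning)

open ≡-Reasoning

0^n∸1≡0 : ∀ n → 0 ^ n ∸ 1 ≡ 0
0^n∸1≡0 zero    = refl
0^n∸1≡0 (suc n) = refl

^∸1-+ : ∀ r a b → r ^ (a + b) ∸ 1 ≡ (r ^ a ∸ 1) * (r ^ b ∸ 1) + (r ^ a ∸ 1) + (r ^ b ∸ 1)
^∸1-+ zero a b rewrite 0^n∸1≡0 a | 0^n∸1≡0 b = 0^n∸1≡0 (a + b)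
^∸1-+ r@(suc _) a b = begin
  r ^ (a + b) ∸ 1         ≡⟨ cong (_∸ 1) (^-distribˡ-+-* r a b) ⟩
  r ^ a * r ^ b ∸ 1       ≡⟨ cong₂ (λ x y → x * y ∸ 1) (suc-pred (r ^ a) {{m^n≢0 r a}})
                                                       (suc-pred (r ^ b) {{m^n≢0 r b}}) ⟨
  suc x * suc y ∸ 1       ≡⟨ expand x y ⟩
  x * y + x + y           ∎
  where
  x = r ^ a ∸ 1
  y = r ^ b ∸ 1
  expand : ∀ x y → y + x * suc y ≡ x * y + x + y
  expand = solve-∀

∣^∸1-+ : ∀ {m r} a b → m ∣ r ^ a ∸ 1 → m ∣ r ^ b ∸ 1 → m ∣ r ^ (a + b) ∸ 1
∣^∸1-+ {m} {r} a b m∣a m∣b =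
  subst (m ∣_) (sym (^∸1-+ r a b)) (∣m∣n⇒∣m+n (∣m∣n⇒∣m+n (∣m⇒∣m*n _ m∣a) m∣a) m∣b)

∣^∸1-cancelˡ : ∀ {m r} a b → m ∣ r ^ a ∸ 1 → m ∣ r ^ (a + b) ∸ 1 → m ∣ r ^ b ∸ 1
∣^∸1-cancelˡ {m} {r} a b m∣a m∣a+b =
  ∣m+n∣m⇒∣n (subst (m ∣_) (^∸1-+ r a b) m∣a+b) (∣m∣n⇒∣m+n (∣m⇒∣m*n _ m∣a) m∣a)

∣^∸1-* : ∀ {m r a} q → m ∣ r ^ a ∸ 1 → m ∣ r ^ (q * a) ∸ 1
∣^∸1-* zero    m∣a = _ ∣0
∣^∸1-* {a = a} (suc q) m∣a = ∣^∸1-+ a (q * a) m∣a (∣^∸1-* q m∣a)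

∣^∸1-∣ : ∀ {m r a b} → m ∣ r ^ a ∸ 1 → a ∣ b → m ∣ r ^ b ∸ 1
∣^∸1-∣ m∣a (divides-refl q) = ∣^∸1-* q m∣a

record LeastExponentFrom (i m r k : ℕ) : Set where
  field
    from≤   : i ≤ k
    ∣pow∸1  : m ∣ r ^ k ∸ 1
    minimal : ∀ {j} → i ≤ j → j < k → ¬ m ∣ r ^ j ∸ 1

open LeastExponentFrom

IsOrder : ℕ → ℕ → ℕ → Set
IsOrder = LeastExponentFrom 1

leastFrom-suc⁻ : ∀ {i m r k} → ¬ m ∣ r ^ i ∸ 1 →
                 LeastExponentFrom (suc i) m r k → LeastExponentFrom i m r k
leastFrom-suc⁻ {i} {m} {r} {k} m∤i least =
  record { from≤ = <⇒≤ (from≤ least) ; ∣pow∸1 = ∣pow∸1 least ; minimal = minimal′ }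
  where
  minimal′ : ∀ {j} → i ≤ j → j < k → ¬ m ∣ r ^ j ∸ 1
  minimal′ i≤j j<k with m≤n⇒m<n∨m≡n i≤j
  ... | inj₁ i<j  = minimal least i<j j<k
  ... | inj₂ refl = m∤i

leastFrom-suc⁺ : ∀ {i m r k} → i < k → LeastExponentFrom i m r k → LeastExponentFrom (suc i) m r k
leastFrom-suc⁺ i<k least =
  record { from≤ = i<k ; ∣pow∸1 = ∣pow∸1 least ; minimal = minimal least ∘ <⇒≤ }

ordSearch-sound : ∀ m r f i → ordSearch m r f i ≡ 0
                  ⊎ (LeastExponentFrom i m r (ordSearch m r f i) × ordSearch m r f i < i + f)
ordSearch-sound m r zero    i = inj₁ refl
ordSearch-sound m r (suc f) i with m ∣? (r ^ i ∸ 1)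
... | yes m∣i = inj₂ (least-from-i , m<m+n i z<s)
  where
  least-from-i : LeastExponentFrom i m r i
  least-from-i = record
    { from≤ = ≤-refl ; ∣pow∸1 = m∣i ; minimal = λ i≤j j<i → contradiction i≤j (<⇒≱ j<i) }
... | no m∤i with ordSearch-sound m r f (suc i)
...   | inj₁ k≡0             = inj₁ k≡0
...   | inj₂ (least , k<i+f) =
        inj₂ (leastFrom-suc⁻ m∤i least , subst (ordSearch m r f (suc i) <_) (sym (+-suc i f)) k<i+f)

ordSearch-complete : ∀ {m r k} f i → LeastExponentFrom i m r k → k < i + f → ordSearch m r f i ≡ k
ordSearch-complete {k = k} zero i least k<i+0 =
  contradiction (from≤ least) (<⇒≱ (subst (k <_) (+-identityʳ i) k<i+0))
ordSearch-complete {m} {r} {k} (suc f) i least k<i+f with m ∣? (r ^ i ∸ 1) | m≤n⇒m<n∨m≡n (from≤ least)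
... | yes m∣i | inj₁ i<k  = contradiction m∣i (minimal least ≤-refl i<k)
... | yes _   | inj₂ i≡k  = i≡k
... | no m∤i  | inj₂ refl = contradiction (∣pow∸1 least) m∤i
... | no _    | inj₁ i<k  =
  ordSearch-complete f (suc i) (leastFrom-suc⁺ i<k least) (subst (k <_) (+-suc i f) k<i+f)

ord≢0⇒isOrder : ∀ m r → ord m r ≢ 0 → IsOrder m r (ord m r) × ord m r ≤ m
ord≢0⇒isOrder m r ord≢0 with ordSearch-sound m r m 1
... | inj₁ ord≡0             = contradiction ord≡0 ord≢0
... | inj₂ (isOrder , o<1+m) = isOrder , s≤s⁻¹ o<1+m

ord-complete : ∀ {m r k} → IsOrder m r k → k ≤ m → ord m r ≡ k
ord-complete isOrder k≤m = ordSearch-complete _ 1 isOrder (s≤s k≤m)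

isOrder⇒∣ : ∀ {m r o j} → IsOrder m r o → m ∣ r ^ j ∸ 1 → o ∣ j
isOrder⇒∣ {o = zero} isOrder _ = contradiction (from≤ isOrder) λ ()
isOrder⇒∣ {m} {r} {o@(suc _)} {j} isOrder m∣j with j % o in j%o≡s | m∣r^[j%o]∸1 | m%n<n j o
  where
  j≡q*o+s : j ≡ j / o * o + j % o
  j≡q*o+s = trans (m≡m%n+[m/n]*n j o) (+-comm (j % o) (j / o * o))
  m∣r^[j%o]∸1 : m ∣ r ^ (j % o) ∸ 1
  m∣r^[j%o]∸1 = ∣^∸1-cancelˡ (j / o * o) (j % o) (∣^∸1-* (j / o) (∣pow∸1 isOrder))
                  (subst (λ k → m ∣ r ^ k ∸ 1) j≡q*o+s m∣j)
... | zero  | _   | _   = m%n≡0⇒n∣m j o j%o≡s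
... | suc _ | m∣s | s<o = contradiction m∣s (minimal isOrder (s≤s z≤n) s<o)

coprime-∣⇒*∣ : ∀ {m n x} → Coprime m n → m ∣ x → n ∣ x → m * n ∣ x
coprime-∣⇒*∣ {m} {n} coprime (divides-refl q) n∣q*m =
  subst (_∣ q * m) (*-comm n m)
    (*-monoˡ-∣ m (coprime-divisor (Coprime-sym coprime) (subst (n ∣_) (*-comm q m) n∣q*m)))

prime∤⇒coprime : ∀ {p n} → Prime p → ¬ p ∣ n → Coprime p n
prime∤⇒coprime p-prime p∤n (d∣p , d∣n) with prime⇒irreducible p-prime d∣p
... | inj₁ d≡1    = d≡1
... | inj₂ refl   = contradiction d∣n p∤n

isOrder-* : ∀ {a b r x y} → Coprime a b → Coprime x y →
            IsOrder a r x → IsOrder b r y → IsOrder (a * b) r (x * y)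
isOrder-* {a} {b} {r} {x} {y} coprime-ab coprime-xy ord-a ord-b = record
  { from≤ = *-mono-≤ (from≤ ord-a) (from≤ ord-b)
  ; ∣pow∸1 = coprime-∣⇒*∣ coprime-ab (∣^∸1-∣ (∣pow∸1 ord-a) (m∣m*n {x} y))
                                             (∣^∸1-∣ (∣pow∸1 ord-b) (n∣m*n x {y}))
  ; minimal = λ {j} 1≤j j<xy ab∣j →
      let xy∣j = coprime-∣⇒*∣ coprime-xy (isOrder⇒∣ ord-a (∣-trans (m∣m*n b) ab∣j))
                                         (isOrder⇒∣ ord-b (∣-trans (n∣m*n a) ab∣j))
      in contradiction (∣⇒≤ {{>-nonZero 1≤j}} xy∣j) (<⇒≱ j<xy)
  }

m%n≡1+k⇒[m∸1]%n≡k : ∀ {m n k} .{{_ : NonZero n}} → m % n ≡ suc k → (m ∸ 1) % n ≡ k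
m%n≡1+k⇒[m∸1]%n≡k {m} {n} {k} m%n≡1+k = begin
  (m ∸ 1) % n                       ≡⟨ cong (λ x → (x ∸ 1) % n) (m≡m%n+[m/n]*n m n) ⟩
  (m % n + m / n * n ∸ 1) % n       ≡⟨ cong (λ x → (x + m / n * n ∸ 1) % n) m%n≡1+k ⟩
  (k + m / n * n) % n               ≡⟨ [m+kn]%n≡m%n k (m / n) n ⟩
  k % n                             ≡⟨ m<n⇒m%n≡m (<⇒≤ (subst (_< n) m%n≡1+k (m%n<n m n))) ⟩
  k                                 ∎

m%n≡1⇒n∣m∸1 : ∀ m {n} .{{_ : NonZero n}} → m % n ≡ 1 → n ∣ m ∸ 1
m%n≡1⇒n∣m∸1 m {n} m%n≡1 = m%n≡0⇒n∣m (m ∸ 1) n (m%n≡1+k⇒[m∸1]%n≡k m%n≡1)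

m%n≡2⇒n∤m∸1 : ∀ m {n} .{{_ : NonZero n}} → m % n ≡ 2 → ¬ n ∣ m ∸ 1
m%n≡2⇒n∤m∸1 m {n} m%n≡2 n∣m∸1 =
  contradiction (trans (sym (m%n≡1+k⇒[m∸1]%n≡k m%n≡2)) (n∣m⇒m%n≡0 (m ∸ 1) n n∣m∸1)) λ ()

%-distribˡ-^ : ∀ m n d .{{_ : NonZero d}} → (m ^ n) % d ≡ ((m % d) ^ n) % d
%-distribˡ-^ m zero    d = refl
%-distribˡ-^ m (suc n) d = begin
  (m * m ^ n) % d                       ≡⟨ %-distribˡ-* m (m ^ n) d ⟩
  (m % d * (m ^ n % d)) % d             ≡⟨ cong (λ x → (m % d * x) % d) (%-distribˡ-^ m n d) ⟩
  (m % d * ((m % d) ^ n % d)) % d       ≡⟨ cong (λ x → (x * ((m % d) ^ n % d)) % d) (m%n%n≡m%n m d) ⟨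
  (m % d % d * ((m % d) ^ n % d)) % d   ≡⟨ %-distribˡ-* (m % d) ((m % d) ^ n) d ⟨
  (m % d * (m % d) ^ n) % d             ∎

r%3≡1⇒3∣r^n∸1 : ∀ r n → r % 3 ≡ 1 → 3 ∣ r ^ n ∸ 1
r%3≡1⇒3∣r^n∸1 r n r%3≡1 = m%n≡1⇒n∣m∸1 (r ^ n) (begin
  r ^ n % 3          ≡⟨ %-distribˡ-^ r n 3 ⟩
  (r % 3) ^ n % 3    ≡⟨ cong (λ x → x ^ n % 3) r%3≡1 ⟩
  1 ^ n % 3          ≡⟨ cong (_% 3) (^-zeroˡ n) ⟩
  1                  ∎)

r%3≡2⇒isOrder[3,r,2] : ∀ r → r % 3 ≡ 2 → IsOrder 3 r 2
r%3≡2⇒isOrder[3,r,2] r r%3≡2 = record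
  { from≤ = s≤s z≤n
  ; ∣pow∸1 = m%n≡1⇒n∣m∸1 (r ^ 2) (r^n%3≡2^n%3 2)
  ; minimal = λ { (s≤s z≤n) (s≤s (s≤s z≤n)) → m%n≡2⇒n∤m∸1 (r ^ 1) (r^n%3≡2^n%3 1) }
  }
  where
  r^n%3≡2^n%3 : ∀ n → r ^ n % 3 ≡ 2 ^ n % 3
  r^n%3≡2^n%3 n = trans (%-distribˡ-^ r n 3) (cong (λ x → x ^ n % 3) r%3≡2)

div≡/ : ∀ m n .{{_ : NonZero n}} → m div n ≡ m / n
div≡/ m (suc _) = refl

module _ (m r t : ℕ) .{{_ : NonZero m}} where
  private
    g = gcd m (t * S (ord m r) r)
    instance
      g≢0 : NonZero g
      g≢0 = ≢-nonZero (gcd[m,n]≢0 m _ (inj₁ (≢-nonZero⁻¹ m)))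

  κ≡ord*[m/gcd] : κ m r t ≡ ord m r * (m / g)
  κ≡ord*[m/gcd] = begin
    (m * ord m r) div g   ≡⟨ div≡/ (m * ord m r) g ⟩
    (m * ord m r) / g     ≡⟨ cong (_/ g) (*-comm m (ord m r)) ⟩
    (ord m r * m) / g     ≡⟨ *-/-assoc (ord m r) (gcd[m,n]∣m m _) ⟩
    ord m r * (m / g)     ∎

  ord∣κ : ord m r ∣ κ m r t
  ord∣κ = subst (ord m r ∣_) (sym κ≡ord*[m/gcd]) (m∣m*n (m / g))

  κ∣ord*m : κ m r t ∣ ord m r * m
  κ∣ord*m =
    subst (_∣ ord m r * m) (sym κ≡ord*[m/gcd]) (*-monoʳ-∣ (ord m r) (m/n∣m (gcd[m,n]∣m m _)))

gcd[x,q*n]≡n : ∀ {q n x} → Prime q → n ∣ x → ¬ q ∣ x → gcd x (q * n) ≡ n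
gcd[x,q*n]≡n {q} {n} {x} q-prime n∣x q∤x = ∣-antisym g∣n (gcd-greatest n∣x (n∣m*n q))
  where
  q∤g : ¬ q ∣ gcd x (q * n)
  q∤g q∣g = q∤x (∣-trans q∣g (gcd[m,n]∣m x (q * n)))
  g∣n : gcd x (q * n) ∣ n
  g∣n = coprime-divisor (Coprime-sym (prime∤⇒coprime q-prime q∤g)) (gcd[m,n]∣n x (q * n))

⌊⌋-true : ∀ {a} {A : Set a} (a? : Dec A) → A → ⌊ a? ⌋ ≡ true
⌊⌋-true a? a = trans (isYes≗does a?) (dec-true a? a)

⌊⌋-false : ∀ {a} {A : Set a} (a? : Dec A) → ¬ A → ⌊ a? ⌋ ≡ false
⌊⌋-false a? ¬a = trans (isYes≗does a?) (dec-false a? ¬a)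

module _ (p d r t : ℕ) where
  private
    inΛ? : Decidable (λ ℓ → inΛ p d r t ℓ ≡ true)
    inΛ? ℓ = inΛ p d r t ℓ Bool.≟ true

    summand : ℕ → ℕ
    summand ℓ = d * φ (ord (3 * p) r div (ℓ * gcd (κ d r t) (ord (3 * p) r)))

  Λ≡[] : (∀ ℓ → inΛ p d r t ℓ ≡ false) → Λ p d r t ≡ []
  Λ≡[] never = filter-none inΛ? (applyUpTo⁺₂ suc (Mbound p d r t) (λ ℓ → not-¬ (never (suc ℓ))))

  Λ≡[1] : Mbound p d r t ≡ 2 → inΛ p d r t 1 ≡ true → inΛ p d r t 2 ≡ false → Λ p d r t ≡ 1 ∷ []
  Λ≡[1] M≡2 in1 out2 = begin
    Λ p d r t                   ≡⟨ cong (λ M → filter inΛ? (range1 M)) M≡2 ⟩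
    filter inΛ? (1 ∷ 2 ∷ [])    ≡⟨ filter-accept inΛ? {x = 1} in1 ⟩
    1 ∷ filter inΛ? (2 ∷ [])    ≡⟨ cong (1 ∷_) (filter-reject inΛ? {x = 2} (not-¬ out2)) ⟩
    1 ∷ []                      ∎

  Λ≡[]⇒𝒮≡0 : Λ p d r t ≡ [] → 𝒮 p d r t ≡ 0
  Λ≡[]⇒𝒮≡0 = cong (sum ∘ map summand)

  Λ≡[1]⇒𝒮≡d*φ[M] : Λ p d r t ≡ 1 ∷ [] → 𝒮 p d r t ≡ d * φ (Mbound p d r t)
  Λ≡[1]⇒𝒮≡d*φ[M] Λ≡[1] = begin
    𝒮 p d r t                  ≡⟨ cong (sum ∘ map summand) Λ≡[1] ⟩
    summand 1 + 0              ≡⟨ +-identityʳ (summand 1) ⟩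
    d * φ (O div (1 * G))      ≡⟨ cong (λ x → d * φ (O div x)) (*-identityˡ G) ⟩
    d * φ (Mbound p d r t)     ∎
    where
    O = ord (3 * p) r
    G = gcd (κ d r t) O

module _ (p r t : ℕ) (p-prime : Prime p) (3<p : 3 < p) where
  private
    K = κ p r t
    o = ord p r
    instance
      p≢0 : NonZero p
      p≢0 = prime⇒nonZero p-prime

    3∤p : ¬ 3 ∣ p
    3∤p 3∣p = Prime.notComposite p-prime (composite 3<p 3∣p)

    2∤p : ¬ 2 ∣ p
    2∤p 2∣p = Prime.notComposite p-prime (composite (<-trans (n<1+n 2) 3<p) 2∣p)

  inΛ[p]-false : ∀ ℓ → 3 ∣ r ^ (ℓ * K) ∸ 1 → inΛ p p r t ℓ ≡ false
  inΛ[p]-false ℓ 3∣x = trans (cong (⌊ ℓ ∣? Mbound p p r t ⌋ ∧_) (⌊⌋-false _ gcd≢p)) (∧-zeroʳ _)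
    where
    gcd≢p : gcd (r ^ (ℓ * K) ∸ 1) (3 * p) ≢ p
    gcd≢p gcd≡p = 3∤p (subst (3 ∣_) gcd≡p (gcd-greatest 3∣x (m∣m*n p)))

  inΛ[p]-true : ∀ ℓ → ℓ ∣ Mbound p p r t → p ∣ r ^ (ℓ * K) ∸ 1 → ¬ 3 ∣ r ^ (ℓ * K) ∸ 1 →
                inΛ p p r t ℓ ≡ true
  inΛ[p]-true _ ℓ∣M p∣x 3∤x =
    cong₂ _∧_ (⌊⌋-true (_ ∣? _) ℓ∣M) (⌊⌋-true (_ ≟ _) (gcd[x,q*n]≡n prime[3] p∣x 3∤x))
    where
    prime[3] : Prime 3
    prime[3] = from-yes (prime? 3)

  𝒮[p]≡0 : 3 ∣ r ^ K ∸ 1 → 𝒮 p p r t ≡ 0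
  𝒮[p]≡0 3∣r^K∸1 =
    Λ≡[]⇒𝒮≡0 p p r t (Λ≡[] p p r t (λ ℓ → inΛ[p]-false ℓ (∣^∸1-∣ 3∣r^K∸1 (n∣m*n ℓ))))

  3∣r^κ∸1 : gcd r (3 * p) ≡ 1 → ¬ (r % 3 ≡ 2 × ¬ 2 ∣ o) → 3 ∣ r ^ K ∸ 1
  3∣r^κ∸1 gcd≡1 not-odd-case with r % 3 in r%3≡ | m%n<n r 3
  ... | 0 | _ =
    contradiction (∣1⇒≡1 (subst (3 ∣_) gcd≡1 (gcd-greatest (m%n≡0⇒n∣m r 3 r%3≡) (m∣m*n p)))) λ ()
  ... | 1 | _ = r%3≡1⇒3∣r^n∸1 r K r%3≡
  ... | suc (suc (suc _)) | s≤s (s≤s (s≤s ()))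
  ... | 2 | _ = ∣^∸1-∣ (∣pow∸1 (r%3≡2⇒isOrder[3,r,2] r r%3≡)) (∣-trans 2∣o (ord∣κ p r t))
    where
    2∣o : 2 ∣ o
    2∣o = decidable-stable (2 ∣? o) (λ o-odd → not-odd-case (refl , o-odd))

  module _ (r%3≡2 : r % 3 ≡ 2) (o-odd : ¬ 2 ∣ o) where
    private
      o≢0 : o ≢ 0
      o≢0 o≡0 = o-odd (subst (2 ∣_) (sym o≡0) (2 ∣0))

      instance
        o-nonZero : NonZero o
        o-nonZero = ≢-nonZero o≢0

      ord[p] : IsOrder p r o
      ord[p] = proj₁ (ord≢0⇒isOrder p r o≢0)

      ord[3] : IsOrder 3 r 2
      ord[3] = r%3≡2⇒isOrder[3,r,2] r r%3≡2

      K-odd : ¬ 2 ∣ K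
      K-odd 2∣K = [ o-odd , 2∤p ]′ (euclidsLemma o p prime[2] (∣-trans 2∣K (κ∣ord*m p r t)))

    ord[3p]≡2*ord[p] : ord (3 * p) r ≡ 2 * o
    ord[3p]≡2*ord[p] = ord-complete
      (isOrder-* (Coprime-sym (prime⇒coprime p-prime 3<p)) (prime∤⇒coprime prime[2] o-odd) ord[3] ord[p])
      (*-mono-≤ (n≤1+n 2) (proj₂ (ord≢0⇒isOrder p r o≢0)))

    Mbound[p]≡2 : Mbound p p r t ≡ 2
    Mbound[p]≡2 = begin
      O div gcd K O               ≡⟨ cong (λ O → O div gcd K O) ord[3p]≡2*ord[p] ⟩
      (2 * o) div gcd K (2 * o)   ≡⟨ cong ((2 * o) div_) (gcd[x,q*n]≡n prime[2] (ord∣κ p r t) K-odd) ⟩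
      (2 * o) div o               ≡⟨ div≡/ (2 * o) o ⟩
      2 * o / o                   ≡⟨ m*n/n≡m 2 o ⟩
      2                           ∎
      where O = ord (3 * p) r

    Λ[p]≡[1] : Λ p p r t ≡ 1 ∷ []
    Λ[p]≡[1] = Λ≡[1] p p r t Mbound[p]≡2 in1 out2
      where
      in1 : inΛ p p r t 1 ≡ true
      in1 = inΛ[p]-true 1 (1∣ _) (∣^∸1-∣ (∣pow∸1 ord[p]) (∣n⇒∣m*n 1 (ord∣κ p r t)))
                        (K-odd ∘ subst (2 ∣_) (*-identityˡ K) ∘ isOrder⇒∣ ord[3])
      out2 : inΛ p p r t 2 ≡ false
      out2 = inΛ[p]-false 2 (∣^∸1-∣ (∣pow∸1 ord[3]) (m∣m*n {2} K))

    𝒮[p]≡p : 𝒮 p p r t ≡ p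
    𝒮[p]≡p = begin
      𝒮 p p r t                   ≡⟨ Λ≡[1]⇒𝒮≡d*φ[M] p p r t Λ[p]≡[1] ⟩
      p * φ (Mbound p p r t)      ≡⟨ cong (λ M → p * φ M) Mbound[p]≡2 ⟩
      p * 1                       ≡⟨ *-identityʳ p ⟩
      p                           ∎

lemma5p7 : (p t r : ℕ) → Prime p → 3 < p
             → (t ≡ 1 ⊎ t ≡ 3 ⊎ t ≡ p ⊎ t ≡ 3 * p)
             → 1 ≤ r → r ≤ 3 * p ∸ 1 → gcd r (3 * p) ≡ 1
             → ((r % 3 ≡ 2 × ¬ (2 ∣ ord p r)) → 𝒮 p p r t ≡ p)
               × (¬ (r % 3 ≡ 2 × ¬ (2 ∣ ord p r)) → 𝒮 p p r t ≡ 0)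
lemma5p7 p t r p-prime 3<p _ _ _ gcd≡1 =
    (λ (r%3≡2 , o-odd) → 𝒮[p]≡p p r t p-prime 3<p r%3≡2 o-odd)
  , (λ not-odd-case → 𝒮[p]≡0 p r t p-prime 3<p (3∣r^κ∸1 p r t p-prime 3<p gcd≡1 not-odd-case))
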